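{- For every instance of the Minimum Cost Markov Chain problem (as described in the context), the Iterative Algorithm terminates after finitely many iterations. Furthermore, if it terminates with $\mathbf p_n=\mathbf p_{n-1}$ and outputs $\mathbf S(\mathbf p_n)$, then $\mathbf S(\mathbf p_n)$ is a minimum cost permissible Markov chain, and the multi-typed intersection point associated with $\mathbf S(\mathbf p_n)$ lies in $\mathbb{H}$.
   Context: Fix an integer $m>1$. For each $k\in\{0,\ldots,m-1\}$ let $\mathbb{S}_k$ be a finite nonempty set of permissible states of type $k$. Each $S\in\mathbb{S}_k$ has a real cost $\ell(S)\ge 0$ and transition probabilities $q_0(S),\ldots,q_{m-1}(S)\ge 0$ with $\sum_j q_j(S)=1$ and $q_0(S)>0$. A permissible Markov chain is a tuple $\mathbf S=(S_0,\ldots,S_{m-1})$ with $S_k\in\mathbb{S}_k$; it is the Markov chain on $\{0,\ldots,m-1\}$ whose transition probability from $k$ to $j$ is $q_j(S_k)$. It has a unique stationary distribution $\pi(\mathbf S)=(\pi_0,\ldots,\pi_{m-1})$ and cost $\mathrm{cost}(\mathbf S)=\sum_k\ell(S_k)\pi_k(\mathbf S)$. The Minimum Cost Markov Chain problem asks for a permissible $\mathbf S$ minimizing $\mathrm{cost}(\mathbf S)$. For $\mathbf x=(x_1,\ldots,x_{m-1})\in\mathbb{R}^{m-1}$ define $f_0(\mathbf x,S)=\ell(S)+\sum_{j=1}^{m-1}q_j(S)x_j$ ($S\in\mathbb{S}_0$) and, for $k\ge1$, $f_k(\mathbf x,S)=\ell(S)+\sum_{j=1}^{m-1}q_j(S)x_j-x_k$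 ($S\in\mathbb{S}_k$). Let $g_k(\mathbf x)=\min_{S\in\mathbb{S}_k}f_k(\mathbf x,S)$, let $S_k(\mathbf x)$ denote a minimizer (argmin), $\mathbf S(\mathbf x)=(S_0(\mathbf x),\ldots,S_{m-1}(\mathbf x))$, $h(\mathbf x)=\min_k g_k(\mathbf x)$, and $\mathbb{H}=\{(\mathbf x,y)\in\mathbb{R}^m: 0\le y\le h(\mathbf x)\}$. For every permissible $\mathbf S$, the $m$ equations $y=f_k(\mathbf x,S_k)$, $k=0,\ldots,m-1$, have a unique common solution $(\mathbf x,y)\in\mathbb{R}^{m}$, called the multi-typed intersection point corresponding to $\mathbf S$ (and then $y=\mathrm{cost}(\mathbf S)$). The Iterative Algorithm: let $\mathbf p_0\in\mathbb{R}^{m-1}$ be the $\mathbf x$-part of the multi-typed intersection point of an arbitrary permissible chain; for $i=1,2,\ldots$ let $\mathbf p_i$ be the $\mathbf x$-part of the multi-typed intersection point corresponding to $\mathbf S(\mathbf p_{i-1})$; stop as soon as $\mathbf p_i=\mathbf p_{i-1}$ and output $\mathbf S(\mathbf p_i)$. -}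

module Defs where

open import Level using (0ℓ)
open import Data.Nat using (ℕ; zero; suc)
open import Data.Fin using (Fin; zero; suc)
open import Data.Product using (Σ; ∃; ∃-syntax; _×_; _,_)
open import Relation.Binary.PropositionalEquality using (_≡_; _≢_)
open import Relation.Binary.Structures using (IsTotalOrder)
open import Relation.Binary.Definitions using (Decidable)
open import Relation.Nullary using (¬_; yes; no)
open import Algebra.Structures using (IsCommutativeRing)

-- The real numbers, axiomatised as a (Dedekind-)complete ordered field.
-- (Up to isomorphism, ℝ is the unique such structure.)  Equality is
-- propositional equality on the carrier; the order is total and (as in
-- classical mathematics) decidable.

record RealField : Set₁ where
  infixl 6 _+_
  infixl 7 _*_
  infix  4 _≤_
  field
    Carrier : Set
    _+_ _*_ : Carrier → Carrier → Carrier
    -_      : Carrier → Carrier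
    0# 1#   : Carrier
    isCommutativeRing : IsCommutativeRing _≡_ _+_ _*_ -_ 0# 1#
    0≢1     : 0# ≢ 1#
    inverse : ∀ x → x ≢ 0# → ∃[ y ] (x * y ≡ 1#)
    _≤_     : Carrier → Carrier → Set
    isTotalOrder : IsTotalOrder _≡_ _≤_
    _≤?_    : Decidable _≤_
    +-monoˡ-≤ : ∀ {x y} z → x ≤ y → x + z ≤ y + z
    *-nonneg  : ∀ {x y} → 0# ≤ x → 0# ≤ y → 0# ≤ x * y
    lub : (P : Carrier → Set) → ∃ P → (∃[ b ] (∀ x → P x → x ≤ b)) →
          ∃[ s ] ((∀ x → P x → x ≤ s) ×
                  (∀ b → (∀ x → P x → x ≤ b) → s ≤ b))

  infix 4 _<_
  _<_ : Carrier → Carrier → Set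
  x < y = (x ≤ y) × (x ≢ y)

  infixl 6 _-_
  _-_ : Carrier → Carrier → Carrier
  x - y = x + (- y)

  sumF : (c : ℕ) → (Fin c → Carrier) → Carrier
  sumF zero    v = 0#
  sumF (suc c) v = v zero + sumF c (λ i → v (suc i))

  min : Carrier → Carrier → Carrier
  min x y with x ≤? y
  ... | yes _ = x
  ... | no  _ = y

  minF : (c : ℕ) → (Fin (suc c) → Carrier) → Carrier
  minF zero    v = v zero
  minF (suc c) v = min (v zero) (minF c (λ i → v (suc i)))

-- Minimum Cost Markov Chain instances.
-- m = suc n types, indexed by Fin (suc n); type j ∈ {1,…,m-1} is
-- suc j' with j' : Fin n, and x = (x_1,…,x_{m-1}) is x : Fin n → R,
-- x_{suc j'} being x j'.
-- The permissible states of type k are Fin (suc (nS k)) (finite, nonempty).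

module MCMC (ℝ : RealField) where
  open RealField ℝ

  record Instance (n : ℕ) : Set where
    field
      nS   : Fin (suc n) → ℕ
      ℓ    : (k : Fin (suc n)) → Fin (suc (nS k)) → Carrier
      q    : (k : Fin (suc n)) → Fin (suc (nS k)) → Fin (suc n) → Carrier
      ℓ-nonneg : ∀ k s → 0# ≤ ℓ k s
      q-nonneg : ∀ k s j → 0# ≤ q k s j
      q-sum    : ∀ k s → sumF (suc n) (q k s) ≡ 1#
      q₀-pos   : ∀ k s → 0# < q k s zero

  module _ {n : ℕ} (I : Instance n) where
    open Instance I

    Vecℝ : Set
    Vecℝ = Fin n → Carrier

    Chain : Set
    Chain = (k : Fin (suc n)) → Fin (suc (nS k))

    IsStationary : Chain → (Fin (suc n) → Carrier) → Set
    IsStationary S π =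
      (∀ k → 0# ≤ π k) ×
      (sumF (suc n) π ≡ 1#) ×
      (∀ j → π j ≡ sumF (suc n) (λ k → π k * q k (S k) j))

    -- c is the cost of S: c = Σ_k ℓ(S_k) π_k(S), π(S) the stationary
    -- distribution (unique by the standing assumptions)
    HasCost : Chain → Carrier → Set
    HasCost S c = ∃[ π ] (IsStationary S π ×
                          (c ≡ sumF (suc n) (λ k → ℓ k (S k) * π k)))

    f : (k : Fin (suc n)) → Vecℝ → Fin (suc (nS k)) → Carrier
    f zero     x s = ℓ zero s + sumF n (λ j → q zero s (suc j) * x j)
    f (suc k') x s = ℓ (suc k') s + sumF n (λ j → q (suc k') s (suc j) * x j)
                     - x k'

    g : Fin (suc n) → Vecℝ → Carrier
    g k x = minF (nS k) (f k x)

    h : Vecℝ → Carrier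
    h x = minF n (λ k → g k x)

    InH : Vecℝ → Carrier → Set
    InH x y = (0# ≤ y) × (y ≤ h x)

    IsMTIP : Chain → Vecℝ → Carrier → Set
    IsMTIP S x y = ∀ k → y ≡ f k x (S k)

    IsArgminSelection : (Vecℝ → Chain) → Set
    IsArgminSelection sel = ∀ x k → f k x (sel x k) ≡ g k x

    _≈ᵥ_ : Vecℝ → Vecℝ → Set
    x ≈ᵥ x' = ∀ j → x j ≡ x' j

    -- p is the sequence p_0, p_1, … computed by the Iterative Algorithm
    -- (ignoring the stopping rule) with the argmin selection sel
    IsRun : (Vecℝ → Chain) → (ℕ → Vecℝ) → Set
    IsRun sel p =
      (∃[ S₀ ] ∃[ y ] IsMTIP S₀ (p 0) y) ×
      (∀ i → ∃[ y ] IsMTIP (sel (p i)) (p (suc i)) y)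

    IsMinCost : Chain → Set
    IsMinCost S = ∀ S' c c' → HasCost S c → HasCost S' c' → c ≤ c'

{-# OPTIONS --safe #-}

-- With X = 0 ∷ x (the paper's convention x₀ = 0), f_k(x, s) = ℓ(s) + drift k s X.  Maximum
-- principle: if V₀ = 0 and a ≤ b + drift k (T k) V for every k, then a ≤ b, and V ≤ 0 when a = b,
-- because at a maximiser k of V the drift is at most −q₀ V_k with q₀ > 0.  Applied to the
-- difference of two points this gives a comparison principle: the intersection point of a chain
-- is unique and has y ≥ 0, and as S(pᵢ) minimises every f_k at pᵢ, the pairs (yᵢ, pᵢ) descend
-- lexicographically.  There are finitely many chains, so S(pᵢ) = S(pⱼ) for some i < j; then
-- (y, p) agrees at i + 1 and j + 1 and the descent stalls at i + 1.  At a fixed point x we get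
-- y = g_k(x) for every k.  For any chain S with stationary distribution π the drifts average to
-- 0, so cost(S) = Σ_k π_k f_k(x, S_k) ≥ y = cost(S(x)).

module Submission where

open import Defs
open import Data.Nat using (ℕ; suc; _<_)
open import Data.Product using (∃-syntax; _×_; _,_)
open import Relation.Nullary using (¬_)

open import Level using (0ℓ)
open import Function using (_∘_)
open import Data.Nat as ℕ using (zero; s≤s; _≤′_; ≤′-refl; ≤′-step)
import Data.Nat.Properties as ℕ
open import Data.Fin using (Fin; zero; suc; toℕ; combine)
open import Data.Fin.Properties using (combine-injective; pigeonhole)
open import Data.Product using (proj₁; proj₂)
open import Data.Sum using (inj₁; inj₂)
open import Data.Vec.Functional using (Vector; _∷_)
open import Data.Vec.Functional.Relation.Binary.Pointwise using (Pointwise)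
import Data.Vec.Functional.Relation.Binary.Pointwise.Properties as Pointwise
open import Data.List using (allFin)
import Data.List.Relation.Unary.All as All
open import Data.List.Membership.Propositional.Properties using (∈-allFin)
open import Data.Product.Relation.Binary.Lex.NonStrict using (×-poset)
open import Algebra.Bundles using (CommutativeRing)
open import Relation.Binary.Bundles using (Poset; TotalOrder)
open import Relation.Binary.PropositionalEquality
  using (_≡_; _≢_; refl; sym; trans; cong; cong₂; subst; subst₂; module ≡-Reasoning)
open import Relation.Nullary using (yes; no)
import Relation.Binary.Reasoning.PartialOrder

module DescendingSequence {c ℓ₁ ℓ₂} (P : Poset c ℓ₁ ℓ₂) (z : ℕ → Poset.Carrier P)
                          (descending : ∀ t → Poset._≤_ P (z (suc t)) (z t)) where
  open Poset P using (_≈_; _≤_; antisym) renaming (refl to ≤-refl; trans to ≤-trans)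
  open import Relation.Binary.Reasoning.PartialOrder P

  antitone : ∀ {s t} → s ℕ.≤ t → z t ≤ z s
  antitone s≤t = go (ℕ.≤⇒≤′ s≤t)
    where
    go : ∀ {s t} → s ≤′ t → z t ≤ z s
    go ≤′-refl        = ≤-refl
    go (≤′-step s≤′t) = ≤-trans (descending _) (go s≤′t)

  repetition⇒stalls : ∀ {a b} → a < b → z a ≈ z b → z (suc a) ≈ z a
  repetition⇒stalls {a} {b} a<b za≈zb = antisym (descending _) (begin
    z a       ≈⟨ za≈zb ⟩
    z b       ≤⟨ antitone a<b ⟩
    z (suc a) ∎)

pointwisePoset : ∀ {c ℓ₁ ℓ₂} → Poset c ℓ₁ ℓ₂ → ℕ → Poset c ℓ₁ ℓ₂
pointwisePoset P n = record
  { Carrier        = Vector P.Carrier n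
  ; _≈_            = Pointwise P._≈_
  ; _≤_            = Pointwise P._≤_
  ; isPartialOrder = record
    { isPreorder = record
      { isEquivalence = Pointwise.isEquivalence P.isEquivalence n
      ; reflexive     = λ x≈y i → P.reflexive (x≈y i)
      ; trans         = λ x≤y y≤z i → P.trans (x≤y i) (y≤z i)
      }
    ; antisym    = λ x≤y y≤x i → P.antisym (x≤y i) (y≤x i)
    }
  }
  where module P = Poset P

∏ : (m : ℕ) → (Fin m → ℕ) → ℕ
∏ zero    b = 1
∏ (suc m) b = b zero ℕ.* ∏ m (b ∘ suc)

encodeΠ : ∀ {m} {b : Fin m → ℕ} → ((k : Fin m) → Fin (b k)) → Fin (∏ m b)
encodeΠ {zero}  S = zero
encodeΠ {suc m} S = combine (S zero) (encodeΠ (S ∘ suc))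

encodeΠ-injective : ∀ {m} {b : Fin m → ℕ} (S T : (k : Fin m) → Fin (b k)) →
                    encodeΠ S ≡ encodeΠ T → ∀ k → S k ≡ T k
encodeΠ-injective {suc m} S T eq zero    = proj₁ (combine-injective (S zero) _ (T zero) _ eq)
encodeΠ-injective {suc m} S T eq (suc k) =
  encodeΠ-injective (S ∘ suc) (T ∘ suc) (proj₂ (combine-injective (S zero) _ (T zero) _ eq)) k

pigeonhole-Π : ∀ {m} {b : Fin m → ℕ} (S : ℕ → (k : Fin m) → Fin (b k)) →
               ∃[ i ] ∃[ j ] i < j × (∀ k → S i k ≡ S j k)
pigeonhole-Π {m} {b} S =
  let i , j , i<j , eq = pigeonhole (ℕ.n<1+n (∏ m b)) (encodeΠ ∘ S ∘ toℕ)
  in toℕ i , toℕ j , i<j , encodeΠ-injective (S (toℕ i)) (S (toℕ j)) eq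

maximum-attained : ∀ {a ℓ₁ ℓ₂} (O : TotalOrder a ℓ₁ ℓ₂) {c} (V : Fin (suc c) → TotalOrder.Carrier O) →
                   ∃[ k ] (∀ j → TotalOrder._≤_ O (V j) (V k))
maximum-attained O {c} V =
  argmax V zero (allFin (suc c)) ,
  λ j → All.lookup (f[xs]≤f[argmax] zero (allFin (suc c))) (∈-allFin j)
  where open import Data.List.Extrema O using (argmax; f[xs]≤f[argmax])

module OrderedFieldProperties (ℝ : RealField) where
  open RealField ℝ

  commutativeRing : CommutativeRing 0ℓ 0ℓ
  commutativeRing = record { isCommutativeRing = isCommutativeRing }

  totalOrder : TotalOrder 0ℓ 0ℓ 0ℓ
  totalOrder = record { isTotalOrder = isTotalOrder }

  open CommutativeRing commutativeRing public
    using ( ring; semiring; +-commutativeSemigroup; +-comm; +-assoc; +-identityˡ; +-identityʳ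
          ; -‿inverseʳ; *-comm; *-assoc; *-identityˡ; *-identityʳ; zeroʳ; distribˡ; distribʳ
          ; *-commutativeSemigroup)
  open TotalOrder totalOrder public
    using (poset; antisym; reflexive) renaming (refl to ≤-refl; trans to ≤-trans)
  open import Relation.Binary.Properties.TotalOrder totalOrder public using (≰⇒≥)
  open import Algebra.Properties.Ring ring public
    using ( -0#≈0#; -‿involutive; -‿+-comm; x[y-z]≈xy-xz; [y-z]x≈yx-zx
          ; \\-leftDividesˡ; \\-leftDividesʳ; //-rightDividesˡ)
  open import Algebra.Properties.CommutativeSemigroup +-commutativeSemigroup public
    using (interchange; x∙yz≈xz∙y)
  open import Algebra.Properties.CommutativeSemigroup *-commutativeSemigroup public
    using () renaming (xy∙z≈y∙zx to xy*z≈y*zx)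
  open import Algebra.Properties.Semiring.Sum semiring public
    using ( sum; sum-syntax; ∑-distrib-+; ∑-comm; *-distribˡ-sum; *-distribʳ-sum
          ; sum-cong-≗; sum-replicate-zero)
  module ≤-Reasoning = Relation.Binary.Reasoning.PartialOrder poset

  +-monoʳ-≤ : ∀ z {x y} → x ≤ y → z + x ≤ z + y
  +-monoʳ-≤ z {x} {y} x≤y = subst₂ _≤_ (+-comm x z) (+-comm y z) (+-monoˡ-≤ z x≤y)

  +-mono-≤ : ∀ {x y u v} → x ≤ y → u ≤ v → x + u ≤ y + v
  +-mono-≤ {y = y} {u} x≤y u≤v = ≤-trans (+-monoˡ-≤ u x≤y) (+-monoʳ-≤ y u≤v)

  +-cancelˡ-≤ : ∀ z {x y} → z + x ≤ z + y → x ≤ y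
  +-cancelˡ-≤ z {x} {y} le =
    subst₂ _≤_ (\\-leftDividesʳ z x) (\\-leftDividesʳ z y) (+-monoʳ-≤ (- z) le)

  -‿antitone-≤ : ∀ {x y} → x ≤ y → - y ≤ - x
  -‿antitone-≤ {x} {y} x≤y = begin
    - y              ≡⟨ \\-leftDividesˡ x (- y) ⟨
    x + (- x + - y)  ≤⟨ +-monoˡ-≤ (- x + - y) x≤y ⟩
    y + (- x + - y)  ≡⟨ cong (y +_) (+-comm (- x) (- y)) ⟩
    y + (- y + - x)  ≡⟨ \\-leftDividesˡ y (- x) ⟩
    - x              ∎
    where open ≤-Reasoning

  x-y≤x : ∀ {x y} → 0# ≤ y → x - y ≤ x
  x-y≤x {x} {y} 0≤y = begin
    x - y    ≤⟨ +-monoʳ-≤ x (-‿antitone-≤ 0≤y) ⟩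
    x - 0#   ≡⟨ cong (x +_) -0#≈0# ⟩
    x + 0#   ≡⟨ +-identityʳ x ⟩
    x        ∎
    where open ≤-Reasoning

  x≤x-y⇒y≤0 : ∀ {x y} → x ≤ x - y → y ≤ 0#
  x≤x-y⇒y≤0 {x} {y} x≤x-y = subst₂ _≤_ (-‿involutive y) -0#≈0# (-‿antitone-≤ 0≤-y)
    where
    0≤-y : 0# ≤ - y
    0≤-y = +-cancelˡ-≤ x (subst (_≤ x - y) (sym (+-identityʳ x)) x≤x-y)

  0≤y-x⇒x≤y : ∀ {x y} → 0# ≤ y - x → x ≤ y
  0≤y-x⇒x≤y {x} {y} le =
    subst₂ _≤_ (+-identityˡ x) (//-rightDividesˡ x y) (+-monoˡ-≤ x le)

  x-y≤0⇒x≤y : ∀ {x y} → x - y ≤ 0# → x ≤ y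
  x-y≤0⇒x≤y {x} {y} le =
    subst₂ _≤_ (//-rightDividesˡ y x) (+-identityˡ y) (+-monoˡ-≤ y le)

  x-[y+x]≡-y : ∀ x y → x - (y + x) ≡ - y
  x-[y+x]≡-y x y = begin
    x - (y + x)     ≡⟨ cong (x +_) (-‿+-comm y x) ⟨
    x + (- y - x)   ≡⟨ cong (x +_) (+-comm (- y) (- x)) ⟩
    x + (- x - y)   ≡⟨ \\-leftDividesˡ x (- y) ⟩
    - y             ∎
    where open ≡-Reasoning

  *-monoˡ-≤ : ∀ {p x y} → 0# ≤ p → x ≤ y → p * x ≤ p * y
  *-monoˡ-≤ {p} {x} {y} 0≤p x≤y =
    0≤y-x⇒x≤y (subst (0# ≤_) (x[y-z]≈xy-xz p y x) (*-nonneg 0≤p 0≤y-x))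
    where
    0≤y-x : 0# ≤ y - x
    0≤y-x = subst (_≤ y - x) (-‿inverseʳ x) (+-monoˡ-≤ (- x) x≤y)

  *-monoʳ-≤ : ∀ {p x y} → 0# ≤ p → x ≤ y → x * p ≤ y * p
  *-monoʳ-≤ {p} {x} {y} 0≤p x≤y = subst₂ _≤_ (*-comm p x) (*-comm p y) (*-monoˡ-≤ 0≤p x≤y)

  x≢0∧x*y≡0⇒y≡0 : ∀ {x y} → x ≢ 0# → x * y ≡ 0# → y ≡ 0#
  x≢0∧x*y≡0⇒y≡0 {x} {y} x≢0 xy≡0 = begin
    y              ≡⟨ *-identityˡ y ⟨
    1# * y         ≡⟨ cong (_* y) x*x⁻¹≡1 ⟨
    (x * x⁻¹) * y  ≡⟨ cong (_* y) (*-comm x x⁻¹) ⟩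
    (x⁻¹ * x) * y  ≡⟨ *-assoc x⁻¹ x y ⟩
    x⁻¹ * (x * y)  ≡⟨ cong (x⁻¹ *_) xy≡0 ⟩
    x⁻¹ * 0#       ≡⟨ zeroʳ x⁻¹ ⟩
    0#             ∎
    where
    open ≡-Reasoning
    x⁻¹ : Carrier
    x⁻¹ = proj₁ (inverse x x≢0)
    x*x⁻¹≡1 : x * x⁻¹ ≡ 1#
    x*x⁻¹≡1 = proj₂ (inverse x x≢0)

  sum-mono-≤ : ∀ {c} {u v : Vector Carrier c} → (∀ i → u i ≤ v i) → sum u ≤ sum v
  sum-mono-≤ {zero}  u≤v = ≤-refl
  sum-mono-≤ {suc c} u≤v = +-mono-≤ (u≤v zero) (sum-mono-≤ (u≤v ∘ suc))

  ∑-distrib-- : ∀ {c} (u v : Vector Carrier c) → ∑[ i < c ] (u i - v i) ≡ sum u - sum v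
  ∑-distrib-- {zero}  u v = sym (-‿inverseʳ 0#)
  ∑-distrib-- {suc c} u v = begin
    (u zero - v zero) + ∑[ i < c ] (u (suc i) - v (suc i))
      ≡⟨ cong ((u zero - v zero) +_) (∑-distrib-- (u ∘ suc) (v ∘ suc)) ⟩
    (u zero - v zero) + (sum (u ∘ suc) - sum (v ∘ suc))
      ≡⟨ interchange (u zero) (- v zero) (sum (u ∘ suc)) (- sum (v ∘ suc)) ⟩
    (u zero + sum (u ∘ suc)) + (- v zero - sum (v ∘ suc))
      ≡⟨ cong ((u zero + sum (u ∘ suc)) +_) (-‿+-comm (v zero) (sum (v ∘ suc))) ⟩
    sum u - sum v ∎
    where open ≡-Reasoning

  sumF≡sum : ∀ c (v : Vector Carrier c) → sumF c v ≡ sum v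
  sumF≡sum zero    v = refl
  sumF≡sum (suc c) v = cong (v zero +_) (sumF≡sum c (v ∘ suc))

  min-≤ˡ : ∀ x y → min x y ≤ x
  min-≤ˡ x y with x ≤? y
  ... | yes _   = ≤-refl
  ... | no  x≰y = ≰⇒≥ x≰y

  min-≤ʳ : ∀ x y → min x y ≤ y
  min-≤ʳ x y with x ≤? y
  ... | yes x≤y = x≤y
  ... | no  _   = ≤-refl

  min-greatest : ∀ {x y z} → z ≤ x → z ≤ y → z ≤ min x y
  min-greatest {x} {y} z≤x z≤y with x ≤? y
  ... | yes _ = z≤x
  ... | no  _ = z≤y

  minF-≤ : ∀ c (v : Fin (suc c) → Carrier) i → minF c v ≤ v i
  minF-≤ zero    v zero    = ≤-refl
  minF-≤ (suc c) v zero    = min-≤ˡ (v zero) (minF c (v ∘ suc))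
  minF-≤ (suc c) v (suc i) = ≤-trans (min-≤ʳ (v zero) (minF c (v ∘ suc))) (minF-≤ c (v ∘ suc) i)

  minF-greatest : ∀ c (v : Fin (suc c) → Carrier) {z} → (∀ i → z ≤ v i) → z ≤ minF c v
  minF-greatest zero    v z≤v = z≤v zero
  minF-greatest (suc c) v z≤v = min-greatest (z≤v zero) (minF-greatest c (v ∘ suc) (z≤v ∘ suc))

  minF-cong : ∀ c {u v : Fin (suc c) → Carrier} → (∀ i → u i ≡ v i) → minF c u ≡ minF c v
  minF-cong zero    u≗v = u≗v zero
  minF-cong (suc c) u≗v = cong₂ min (u≗v zero) (minF-cong c (u≗v ∘ suc))

module IterativeAlgorithm (ℝ : RealField) {n : ℕ} (I : MCMC.Instance ℝ n) where
  open RealField ℝ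
  open OrderedFieldProperties ℝ
  open MCMC ℝ
  open Instance I

  drift : (k : Fin (suc n)) → Fin (suc (nS k)) → Vector Carrier (suc n) → Carrier
  drift k s V = ∑[ j < suc n ] (q k s j * V j) - V k

  drift-cong : ∀ k s {U V} → (∀ j → U j ≡ V j) → drift k s U ≡ drift k s V
  drift-cong k s U≗V = cong₂ _-_ (sum-cong-≗ (λ j → cong (q k s j *_) (U≗V j))) (U≗V k)

  drift-+ : ∀ k s U V → drift k s (λ j → U j + V j) ≡ drift k s U + drift k s V
  drift-+ k s U V = begin
    ∑[ j < suc n ] (q k s j * (U j + V j)) - (U k + V k)
      ≡⟨ cong (_- (U k + V k)) (sum-cong-≗ (λ j → distribˡ (q k s j) (U j) (V j))) ⟩
    ∑[ j < suc n ] (q k s j * U j + q k s j * V j) - (U k + V k)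
      ≡⟨ cong (_- (U k + V k)) (∑-distrib-+ (λ j → q k s j * U j) (λ j → q k s j * V j)) ⟩
    (QU + QV) - (U k + V k)    ≡⟨ cong ((QU + QV) +_) (-‿+-comm (U k) (V k)) ⟨
    (QU + QV) + (- U k - V k)  ≡⟨ interchange QU QV (- U k) (- V k) ⟩
    drift k s U + drift k s V  ∎
    where
    open ≡-Reasoning
    QU QV : Carrier
    QU = ∑[ j < suc n ] (q k s j * U j)
    QV = ∑[ j < suc n ] (q k s j * V j)

  drift-zero : ∀ k s → drift k s (λ _ → 0#) ≡ 0#
  drift-zero k s = begin
    ∑[ j < suc n ] (q k s j * 0#) - 0#  ≡⟨ cong (_- 0#) (sum-cong-≗ (λ j → zeroʳ (q k s j))) ⟩
    ∑[ j < suc n ] 0# - 0#              ≡⟨ cong (_- 0#) (sum-replicate-zero (suc n)) ⟩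
    0# - 0#                             ≡⟨ -‿inverseʳ 0# ⟩
    0#                                  ∎
    where open ≡-Reasoning

  ∑q-tail : ∀ k s (V : Vector Carrier (suc n)) → V zero ≡ 0# →
            ∑[ j < suc n ] (q k s j * V j) ≡ ∑[ j < n ] (q k s (suc j) * V (suc j))
  ∑q-tail k s V V₀≡0 = begin
    q k s zero * V zero + QV′  ≡⟨ cong (λ v → q k s zero * v + QV′) V₀≡0 ⟩
    q k s zero * 0# + QV′      ≡⟨ cong (_+ QV′) (zeroʳ (q k s zero)) ⟩
    0# + QV′                   ≡⟨ +-identityˡ QV′ ⟩
    QV′                        ∎
    where
    open ≡-Reasoning
    QV′ : Carrier
    QV′ = ∑[ j < n ] (q k s (suc j) * V (suc j))

  drift-at-max : ∀ k s V → V zero ≡ 0# → (∀ j → V j ≤ V k) → drift k s V ≤ - (q k s zero * V k)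
  drift-at-max k s V V₀≡0 V≤M = begin
    drift k s V                               ≡⟨ cong (_- M) (∑q-tail k s V V₀≡0) ⟩
    ∑[ j < n ] (q k s (suc j) * V (suc j)) - M
      ≤⟨ +-monoˡ-≤ (- M) (sum-mono-≤ λ j → *-monoˡ-≤ (q-nonneg k s (suc j)) (V≤M (suc j))) ⟩
    ∑[ j < n ] (q k s (suc j) * M) - M        ≡⟨ cong (_- M) (*-distribʳ-sum M (q k s ∘ suc)) ⟨
    Q′ * M - M                                ≡⟨ cong (λ z → Q′ * M - z) M≡q₀M+Q′M ⟩
    Q′ * M - (q₀ * M + Q′ * M)                ≡⟨ x-[y+x]≡-y (Q′ * M) (q₀ * M) ⟩
    - (q₀ * M)                                ∎
    where
    open ≤-Reasoning
    M q₀ Q′ : Carrier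
    M  = V k
    q₀ = q k s zero
    Q′ = ∑[ j < n ] q k s (suc j)
    M≡q₀M+Q′M : M ≡ q₀ * M + Q′ * M
    M≡q₀M+Q′M = ≡.begin
      M                         ≡.≡⟨ *-identityˡ M ⟨
      1# * M                    ≡.≡⟨ cong (_* M) (q-sum k s) ⟨
      sumF (suc n) (q k s) * M  ≡.≡⟨ cong (λ z → (q₀ + z) * M) (sumF≡sum n (q k s ∘ suc)) ⟩
      (q₀ + Q′) * M             ≡.≡⟨ distribʳ M q₀ Q′ ⟩
      q₀ * M + Q′ * M           ≡.∎
      where module ≡ = ≡-Reasoning

  ∑q[0∷x] : ∀ k s x → ∑[ j < suc n ] (q k s j * (0# ∷ x) j) ≡ sumF n (λ j → q k s (suc j) * x j)
  ∑q[0∷x] k s x = trans (∑q-tail k s (0# ∷ x) refl) (sym (sumF≡sum n (λ j → q k s (suc j) * x j)))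

  f≡ℓ+drift : ∀ k x s → f I k x s ≡ ℓ k s + drift k s (0# ∷ x)
  f≡ℓ+drift zero x s = cong (ℓ zero s +_) (begin
    sumF n (λ j → q zero s (suc j) * x j)  ≡⟨ ∑q[0∷x] zero s x ⟨
    Qx                                     ≡⟨ +-identityʳ Qx ⟨
    Qx + 0#                                ≡⟨ cong (Qx +_) -0#≈0# ⟨
    Qx - 0#                                ∎)
    where
    open ≡-Reasoning
    Qx : Carrier
    Qx = ∑[ j < suc n ] (q zero s j * (0# ∷ x) j)
  f≡ℓ+drift (suc k) x s = trans (+-assoc (ℓ (suc k) s) _ (- x k))
    (cong (λ z → ℓ (suc k) s + (z - x k)) (sym (∑q[0∷x] (suc k) s x)))

  f-shift : ∀ k x x′ s → f I k x′ s ≡ f I k x s + drift k s (λ j → (0# ∷ x′) j - (0# ∷ x) j)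
  f-shift k x x′ s = begin
    f I k x′ s                           ≡⟨ f≡ℓ+drift k x′ s ⟩
    ℓ k s + drift k s X′                 ≡⟨ cong (ℓ k s +_) (drift-cong k s X′≗D+X) ⟨
    ℓ k s + drift k s (λ j → D j + X j)  ≡⟨ cong (ℓ k s +_) (drift-+ k s D X) ⟩
    ℓ k s + (drift k s D + drift k s X)  ≡⟨ x∙yz≈xz∙y (ℓ k s) (drift k s D) (drift k s X) ⟩
    ℓ k s + drift k s X + drift k s D    ≡⟨ cong (_+ drift k s D) (f≡ℓ+drift k x s) ⟨
    f I k x s + drift k s D              ∎
    where
    open ≡-Reasoning
    X X′ D : Vector Carrier (suc n)
    X    = 0# ∷ x
    X′   = 0# ∷ x′
    D j  = X′ j - X j
    X′≗D+X : ∀ j → D j + X j ≡ X′ j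
    X′≗D+X j = //-rightDividesˡ (X j) (X′ j)

  f-at-origin : ∀ k s → f I k (λ _ → 0#) s ≡ ℓ k s
  f-at-origin k s = begin
    f I k (λ _ → 0#) s                  ≡⟨ f≡ℓ+drift k (λ _ → 0#) s ⟩
    ℓ k s + drift k s (0# ∷ λ _ → 0#)  ≡⟨ cong (ℓ k s +_) (drift-cong k s 0∷0≗0) ⟩
    ℓ k s + drift k s (λ _ → 0#)       ≡⟨ cong (ℓ k s +_) (drift-zero k s) ⟩
    ℓ k s + 0#                          ≡⟨ +-identityʳ (ℓ k s) ⟩
    ℓ k s                               ∎
    where
    open ≡-Reasoning
    0∷0≗0 : ∀ j → (0# ∷ λ _ → 0#) j ≡ 0#
    0∷0≗0 zero    = refl
    0∷0≗0 (suc j) = refl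

  maximum-principle : (T : Chain I) (V : Vector Carrier (suc n)) {a b : Carrier} → V zero ≡ 0# →
                      (∀ k → a ≤ b + drift k (T k) V) → a ≤ b × (a ≡ b → ∀ j → V j ≤ 0#)
  maximum-principle T V {a} {b} V₀≡0 a≤b+drift = ≤-trans a≤b-P (x-y≤x 0≤P) , a≡b⇒V≤0
    where
    k : Fin (suc n)
    k = proj₁ (maximum-attained totalOrder V)
    V≤M : ∀ j → V j ≤ V k
    V≤M = proj₂ (maximum-attained totalOrder V)
    q₀ P : Carrier
    q₀ = q k (T k) zero
    P  = q₀ * V k
    0≤P : 0# ≤ P
    0≤P = *-nonneg (proj₁ (q₀-pos k (T k))) (subst (_≤ V k) V₀≡0 (V≤M zero))
    a≤b-P : a ≤ b - P
    a≤b-P = ≤-trans (a≤b+drift k) (+-monoʳ-≤ b (drift-at-max k (T k) V V₀≡0 V≤M))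
    a≡b⇒V≤0 : a ≡ b → ∀ j → V j ≤ 0#
    a≡b⇒V≤0 a≡b j = ≤-trans (V≤M j) (reflexive (x≢0∧x*y≡0⇒y≡0 q₀≢0 P≡0))
      where
      q₀≢0 : q₀ ≢ 0#
      q₀≢0 = proj₂ (q₀-pos k (T k)) ∘ sym
      P≡0 : P ≡ 0#
      P≡0 = antisym (x≤x-y⇒y≤0 (subst (_≤ b - P) a≡b a≤b-P)) 0≤P

  _≤ᵥ_ : Vecℝ I → Vecℝ I → Set
  _≤ᵥ_ = Pointwise _≤_

  comparison : (T : Chain I) {x x′ : Vecℝ I} {y y′ : Carrier} →
               (∀ k → y′ ≤ f I k x′ (T k)) → (∀ k → f I k x (T k) ≤ y) →
               y′ ≤ y × (y′ ≡ y → x′ ≤ᵥ x)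
  comparison T {x} {x′} {y} {y′} below above =
    proj₁ principle , λ y′≡y j → x-y≤0⇒x≤y (proj₂ principle y′≡y (suc j))
    where
    D : Vector Carrier (suc n)
    D j = (0# ∷ x′) j - (0# ∷ x) j
    principle : y′ ≤ y × (y′ ≡ y → ∀ j → D j ≤ 0#)
    principle = maximum-principle T D (-‿inverseʳ 0#) λ k → ≤-trans (below k)
      (subst (_≤ y + drift k (T k) D) (sym (f-shift k x x′ (T k))) (+-monoˡ-≤ _ (above k)))

  mtip-resp : ∀ {T T′ x y} → (∀ k → T k ≡ T′ k) → IsMTIP I T′ x y → IsMTIP I T x y
  mtip-resp {x = x} T≗T′ mtip k = trans (mtip k) (cong (f I k x) (sym (T≗T′ k)))

  mtip-unique : ∀ {T x y x′ y′} → IsMTIP I T x y → IsMTIP I T x′ y′ → y ≡ y′ × _≈ᵥ_ I x x′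
  mtip-unique {T} {x} {y} {x′} {y′} mtip mtip′ =
    y≡y′ , λ j → antisym (proj₂ c y≡y′ j) (proj₂ c′ (sym y≡y′) j)
    where
    c : y ≤ y′ × (y ≡ y′ → x ≤ᵥ x′)
    c = comparison T (reflexive ∘ mtip) (reflexive ∘ sym ∘ mtip′)
    c′ : y′ ≤ y × (y′ ≡ y → x′ ≤ᵥ x)
    c′ = comparison T (reflexive ∘ mtip′) (reflexive ∘ sym ∘ mtip)
    y≡y′ : y ≡ y′
    y≡y′ = antisym (proj₁ c) (proj₁ c′)

  mtip-height-nonneg : ∀ {T x y} → IsMTIP I T x y → 0# ≤ y
  mtip-height-nonneg {T} mtip = proj₁ (comparison T origin-below (reflexive ∘ sym ∘ mtip))
    where
    origin-below : ∀ k → 0# ≤ f I k (λ _ → 0#) (T k)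
    origin-below k = subst (0# ≤_) (sym (f-at-origin k (T k))) (ℓ-nonneg k (T k))

  ∑-drift-stationary : ∀ {T π} → IsStationary I T π → ∀ V → ∑[ k < suc n ] (drift k (T k) V * π k) ≡ 0#
  ∑-drift-stationary {T} {π} (_ , _ , balance) V = begin
    ∑[ k < suc n ] (drift k (T k) V * π k)
      ≡⟨ sum-cong-≗ (λ k → [y-z]x≈yx-zx (π k) (QV k) (V k)) ⟩
    ∑[ k < suc n ] (QV k * π k - V k * π k)
      ≡⟨ ∑-distrib-- (λ k → QV k * π k) (λ k → V k * π k) ⟩
    ∑[ k < suc n ] (QV k * π k) - ∑[ k < suc n ] (V k * π k)
      ≡⟨ cong (_- ∑[ k < suc n ] (V k * π k)) inflow≡outflow ⟩
    ∑[ k < suc n ] (V k * π k) - ∑[ k < suc n ] (V k * π k)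
      ≡⟨ -‿inverseʳ _ ⟩
    0# ∎
    where
    open ≡-Reasoning
    QV : Fin (suc n) → Carrier
    QV k = ∑[ j < suc n ] (q k (T k) j * V j)
    πQ≡π : ∀ j → ∑[ k < suc n ] (π k * q k (T k) j) ≡ π j
    πQ≡π j = sym (trans (balance j) (sumF≡sum (suc n) (λ k → π k * q k (T k) j)))
    inflow≡outflow : ∑[ k < suc n ] (QV k * π k) ≡ ∑[ j < suc n ] (V j * π j)
    inflow≡outflow = begin
      ∑[ k < suc n ] (QV k * π k)
        ≡⟨ sum-cong-≗ (λ k → *-distribʳ-sum (π k) (λ j → q k (T k) j * V j)) ⟩
      ∑[ k < suc n ] ∑[ j < suc n ] (q k (T k) j * V j * π k)
        ≡⟨ ∑-comm (λ k j → q k (T k) j * V j * π k) ⟩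
      ∑[ j < suc n ] ∑[ k < suc n ] (q k (T k) j * V j * π k)
        ≡⟨ sum-cong-≗ (λ j → sum-cong-≗ (λ k → xy*z≈y*zx (q k (T k) j) (V j) (π k))) ⟩
      ∑[ j < suc n ] ∑[ k < suc n ] (V j * (π k * q k (T k) j))
        ≡⟨ sum-cong-≗ (λ j → *-distribˡ-sum (V j) (λ k → π k * q k (T k) j)) ⟨
      ∑[ j < suc n ] (V j * ∑[ k < suc n ] (π k * q k (T k) j))
        ≡⟨ sum-cong-≗ (λ j → cong (V j *_) (πQ≡π j)) ⟩
      ∑[ j < suc n ] (V j * π j) ∎

  cost≡average-f : ∀ {T π} → IsStationary I T π → ∀ x →
                   sumF (suc n) (λ k → ℓ k (T k) * π k) ≡ ∑[ k < suc n ] (f I k x (T k) * π k)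
  cost≡average-f {T} {π} stationary x = sym (begin
    ∑[ k < suc n ] (f I k x (T k) * π k)
      ≡⟨ sum-cong-≗ (λ k → trans (cong (_* π k) (f≡ℓ+drift k x (T k))) (distribʳ (π k) _ _)) ⟩
    ∑[ k < suc n ] (ℓ k (T k) * π k + drift k (T k) X * π k)
      ≡⟨ ∑-distrib-+ (λ k → ℓ k (T k) * π k) (λ k → drift k (T k) X * π k) ⟩
    ∑[ k < suc n ] (ℓ k (T k) * π k) + ∑[ k < suc n ] (drift k (T k) X * π k)
      ≡⟨ cong (∑[ k < suc n ] (ℓ k (T k) * π k) +_) (∑-drift-stationary {T} stationary X) ⟩
    ∑[ k < suc n ] (ℓ k (T k) * π k) + 0#
      ≡⟨ +-identityʳ _ ⟩
    ∑[ k < suc n ] (ℓ k (T k) * π k)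
      ≡⟨ sumF≡sum (suc n) (λ k → ℓ k (T k) * π k) ⟨
    sumF (suc n) (λ k → ℓ k (T k) * π k) ∎)
    where
    open ≡-Reasoning
    X : Vector Carrier (suc n)
    X = 0# ∷ x

  average-of-constant : (π : Fin (suc n) → Carrier) → sumF (suc n) π ≡ 1# →
                        ∀ y → ∑[ k < suc n ] (y * π k) ≡ y
  average-of-constant π ∑π≡1 y = begin
    ∑[ k < suc n ] (y * π k)  ≡⟨ *-distribˡ-sum y π ⟨
    y * sum π                 ≡⟨ cong (y *_) (trans (sym (sumF≡sum (suc n) π)) ∑π≡1) ⟩
    y * 1#                    ≡⟨ *-identityʳ y ⟩
    y                         ∎
    where open ≡-Reasoning

  cost≡mtip-height : ∀ {T x y c} → IsMTIP I T x y → HasCost I T c → c ≡ y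
  cost≡mtip-height {T} {x} {y} {c} mtip (π , stationary , c≡∑ℓπ) = begin
    c                                      ≡⟨ c≡∑ℓπ ⟩
    sumF (suc n) (λ k → ℓ k (T k) * π k)   ≡⟨ cost≡average-f {T} stationary x ⟩
    ∑[ k < suc n ] (f I k x (T k) * π k)   ≡⟨ sum-cong-≗ (λ k → cong (_* π k) (mtip k)) ⟨
    ∑[ k < suc n ] (y * π k)               ≡⟨ average-of-constant π (proj₁ (proj₂ stationary)) y ⟩
    y                                      ∎
    where open ≡-Reasoning

  ≤-cost : ∀ {T x y c} → (∀ k → y ≤ f I k x (T k)) → HasCost I T c → y ≤ c
  ≤-cost {T} {x} {y} {c} y≤f (π , stationary , c≡∑ℓπ) = begin
    y                                      ≡⟨ average-of-constant π (proj₁ (proj₂ stationary)) y ⟨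
    ∑[ k < suc n ] (y * π k)               ≤⟨ sum-mono-≤ (λ k → *-monoʳ-≤ (proj₁ stationary k) (y≤f k)) ⟩
    ∑[ k < suc n ] (f I k x (T k) * π k)   ≡⟨ cost≡average-f {T} stationary x ⟨
    sumF (suc n) (λ k → ℓ k (T k) * π k)   ≡⟨ c≡∑ℓπ ⟨
    c                                      ∎
    where open ≤-Reasoning

  g≤f : ∀ k x s → g I k x ≤ f I k x s
  g≤f k x = minF-≤ (nS k) (f I k x)

  f-cong : ∀ k s {x x′} → _≈ᵥ_ I x x′ → f I k x s ≡ f I k x′ s
  f-cong k s {x} {x′} x≈x′ = begin
    f I k x s                    ≡⟨ f≡ℓ+drift k x s ⟩
    ℓ k s + drift k s (0# ∷ x)   ≡⟨ cong (ℓ k s +_) (drift-cong k s 0∷x≗0∷x′) ⟩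
    ℓ k s + drift k s (0# ∷ x′)  ≡⟨ f≡ℓ+drift k x′ s ⟨
    f I k x′ s                   ∎
    where
    open ≡-Reasoning
    0∷x≗0∷x′ : ∀ j → (0# ∷ x) j ≡ (0# ∷ x′) j
    0∷x≗0∷x′ zero    = refl
    0∷x≗0∷x′ (suc j) = x≈x′ j

  g-cong : ∀ k {x x′} → _≈ᵥ_ I x x′ → g I k x ≡ g I k x′
  g-cong k x≈x′ = minF-cong (nS k) (λ s → f-cong k s x≈x′)

  below-envelope⇒min-cost : ∀ {T x y} → IsMTIP I T x y → (∀ k → y ≤ g I k x) → IsMinCost I T
  below-envelope⇒min-cost {x = x} {y} mtip y≤g S′ c c′ cost cost′ =
    subst (_≤ c′) (sym (cost≡mtip-height mtip cost)) (≤-cost y≤f cost′)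
    where
    y≤f : ∀ k → y ≤ f I k x (S′ k)
    y≤f k = ≤-trans (y≤g k) (g≤f k x (S′ k))

  below-envelope⇒InH : ∀ {T x y} → IsMTIP I T x y → (∀ k → y ≤ g I k x) → InH I x y
  below-envelope⇒InH {x = x} mtip y≤g = mtip-height-nonneg mtip , minF-greatest n (λ k → g I k x) y≤g

  module Run (sel : Vecℝ I → Chain I) (sel-minimises : IsArgminSelection I sel)
             (p : ℕ → Vecℝ I) (run : IsRun I sel p) where

    chain : ℕ → Chain I
    chain zero    = proj₁ (proj₁ run)
    chain (suc t) = sel (p t)

    height : ℕ → Carrier
    height zero    = proj₁ (proj₂ (proj₁ run))
    height (suc t) = proj₁ (proj₂ run t)

    mtip : ∀ t → IsMTIP I (chain t) (p t) (height t)
    mtip zero    = proj₂ (proj₂ (proj₁ run))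
    mtip (suc t) = proj₂ (proj₂ run t)

    step-descends : ∀ t → height (suc t) ≤ height t × (height (suc t) ≡ height t → p (suc t) ≤ᵥ p t)
    step-descends t = comparison (sel (p t)) (reflexive ∘ mtip (suc t)) λ k → begin
      f I k (p t) (sel (p t) k)  ≡⟨ sel-minimises (p t) k ⟩
      g I k (p t)                ≤⟨ g≤f k (p t) (chain t k) ⟩
      f I k (p t) (chain t k)    ≡⟨ mtip t k ⟨
      height t                   ∎
      where open ≤-Reasoning

    lexPoset : Poset 0ℓ 0ℓ 0ℓ
    lexPoset = ×-poset poset (pointwisePoset poset n)

    iterate : ℕ → Carrier × Vecℝ I
    iterate t = height t , p t

    iterate-descends : ∀ t → Poset._≤_ lexPoset (iterate (suc t)) (iterate t)
    iterate-descends t with height t ≤? height (suc t)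
    ... | yes hₜ≤hₜ₊₁ = inj₂ (hₜ₊₁≡hₜ , proj₂ (step-descends t) hₜ₊₁≡hₜ)
      where
      hₜ₊₁≡hₜ : height (suc t) ≡ height t
      hₜ₊₁≡hₜ = antisym (proj₁ (step-descends t)) hₜ≤hₜ₊₁
    ... | no  hₜ≰hₜ₊₁ = inj₁ (proj₁ (step-descends t) , λ hₜ₊₁≡hₜ → hₜ≰hₜ₊₁ (reflexive (sym hₜ₊₁≡hₜ)))

    open DescendingSequence lexPoset iterate iterate-descends using (repetition⇒stalls)

    terminates : ∃[ N ] _≈ᵥ_ I (p (suc N)) (p N)
    terminates =
      let i , j , i<j , same-chain = pigeonhole-Π (sel ∘ p)
      in suc i , proj₂ (repetition⇒stalls (s≤s i<j)
                          (mtip-unique (mtip (suc i)) (mtip-resp same-chain (mtip (suc j)))))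

    fixed-point-optimal : ∀ N → _≈ᵥ_ I (p (suc N)) (p N) →
                          IsMinCost I (sel (p (suc N))) ×
                          (∀ x y → IsMTIP I (sel (p (suc N))) x y → InH I x y)
    fixed-point-optimal N stop = below-envelope⇒min-cost mtip* (reflexive ∘ sym ∘ g≡y*) , in-H
      where
      x* : Vecℝ I
      x* = p (suc N)
      y* : Carrier
      y* = height (suc N)
      g≡y* : ∀ k → g I k x* ≡ y*
      g≡y* k = begin
        g I k x*                  ≡⟨ g-cong k stop ⟩
        g I k (p N)               ≡⟨ sel-minimises (p N) k ⟨
        f I k (p N) (sel (p N) k) ≡⟨ f-cong k (sel (p N) k) stop ⟨
        f I k x* (sel (p N) k)    ≡⟨ mtip (suc N) k ⟨
        y*                        ∎
        where open ≡-Reasoning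
      mtip* : IsMTIP I (sel x*) x* y*
      mtip* k = sym (trans (sel-minimises x* k) (g≡y* k))
      in-H : ∀ x y → IsMTIP I (sel x*) x y → InH I x y
      in-H x y mtip′ = below-envelope⇒InH mtip′ λ k →
        let y*≡y , x*≈x = mtip-unique mtip* mtip′
        in reflexive (trans (sym y*≡y) (trans (sym (g≡y* k)) (g-cong k x*≈x)))

theorem1 : (ℝ : RealField) → let open MCMC ℝ in
    (n : ℕ) → 0 < n → (I : Instance n) →
    (sel : Vecℝ I → Chain I) → IsArgminSelection I sel →
    (p : ℕ → Vecℝ I) → IsRun I sel p →
      (∃[ N ] (_≈ᵥ_ I (p (suc N)) (p N)))
      × ((N : ℕ) → _≈ᵥ_ I (p (suc N)) (p N) →
          (∀ i → i < N → ¬ (_≈ᵥ_ I (p (suc i)) (p i))) →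
          IsMinCost I (sel (p (suc N)))
          × (∀ (x : Vecℝ I) (y : RealField.Carrier ℝ) → IsMTIP I (sel (p (suc N))) x y → InH I x y))
theorem1 ℝ n _ I sel sel-minimises p run = terminates , λ N stop _ → fixed-point-optimal N stop
  where open IterativeAlgorithm.Run ℝ I sel sel-minimises p run
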